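{- Every odd extended sun is not $S$-perfect.
   Context: A star is a tree with one vertex adjacent to all others ($K_1,K_2$ included). $\theta_S(G)$ is the minimum number of star subgraphs of $G$ covering $V(G)$; $T\subseteq V(G)$ is $S$-independent if no two of its vertices lie in a common star subgraph (pairwise distance at least $3$), and $\alpha_S(G)$ is the maximum size of such a set. $G$ is $S$-perfect if $\alpha_S(H)=\theta_S(H)$ for every induced subgraph $H$. A vertex is simplicial if its neighbourhood is a clique. Extended sun: let $H$ be a graph with a Hamiltonian cycle $C=v_1v_2\dots v_kv_1$; let $A_1,\dots,A_k$ be mutually disjoint complete graphs (new vertices) with $|A_i|\ge1$; every vertex of $A_i$ is made adjacent to $v_i$ and $v_{i+1}$ (indices mod $k$) so that all vertices of each $A_i$ are simplicial in the resulting graph $H_1$ (each vertex of $A_i$ is adjacent exactly to the rest of $A_i$ and to $v_i,v_{i+1}$). $H_1$ is a $k$-extended sun; it is an odd extended sun if $k$ is odd. -}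

module Defs where

open import Data.Nat using (ℕ; zero; suc; _*_; _≤_; _%_)
open import Data.Nat.DivMod using (m%n<n)
open import Data.Fin using (Fin; toℕ; fromℕ<)
open import Data.Fin.Subset using (Subset; _∈_; _⊆_; ∣_∣)
open import Data.Product using (Σ; ∃; ∃-syntax; _×_; _,_)
open import Data.Sum using (_⊎_)
open import Relation.Nullary using (¬_)
open import Relation.Binary.PropositionalEquality using (_≡_; _≢_)

record Graph (n : ℕ) : Set₁ where
  field
    Adj    : Fin n → Fin n → Set
    sym    : ∀ {u v} → Adj u v → Adj v u
    irrefl : ∀ {u} → ¬ Adj u u
open Graph public

-- Induced subgraphs of G are given by their vertex set U : Subset n.
-- A star subgraph of G[U], given by its vertex set S ⊆ U: some centre c ∈ S
-- is adjacent to every other vertex of S (K₁ and K₂ included).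
IsStar : ∀ {n} → Graph n → Subset n → Subset n → Set
IsStar G U S = S ⊆ U × ∃[ c ] (c ∈ S × (∀ v → v ∈ S → v ≢ c → Adj G c v))

IsStarCover : ∀ {n} → Graph n → Subset n → (k : ℕ) → (Fin k → Subset n) → Set
IsStarCover G U k St =
  (∀ j → IsStar G U (St j)) × (∀ v → v ∈ U → ∃[ j ] v ∈ St j)

IsThetaS : ∀ {n} → Graph n → Subset n → ℕ → Set
IsThetaS G U t =
  (∃[ St ] IsStarCover G U t St) × (∀ k St → IsStarCover G U k St → t ≤ k)

IsSIndep : ∀ {n} → Graph n → Subset n → Subset n → Set
IsSIndep G U T =
  T ⊆ U × (∀ u v → u ∈ T → v ∈ T → u ≢ v →
             ¬ (∃[ S ] (IsStar G U S × u ∈ S × v ∈ S)))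

IsAlphaS : ∀ {n} → Graph n → Subset n → ℕ → Set
IsAlphaS G U a =
  (∃[ T ] (IsSIndep G U T × ∣ T ∣ ≡ a)) × (∀ T → IsSIndep G U T → ∣ T ∣ ≤ a)

SPerfect : ∀ {n} → Graph n → Set
SPerfect {n} G = ∀ (U : Subset n) a t → IsAlphaS G U a → IsThetaS G U t → a ≡ t

next : ∀ {k} → Fin k → Fin k
next {suc k} i = fromℕ< (m%n<n (suc (toℕ i)) (suc k))

-- G is a k-extended sun.  lab w = inj₁ i : w is the cycle vertex v_i;
-- lab w = inj₂ i : w ∈ A_i.
record ExtendedSun {n} (G : Graph n) (k : ℕ) : Set where
  field
    k≥3      : 3 ≤ k
    lab      : Fin n → Fin k ⊎ Fin k
    cyc      : Fin k → Fin n
    cyc-lab  : ∀ i → lab (cyc i) ≡ Data.Sum.inj₁ i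
    lab-cyc  : ∀ w i → lab w ≡ Data.Sum.inj₁ i → w ≡ cyc i
    -- Hamiltonian cycle v_1 v_2 … v_k v_1 of H (other edges of H arbitrary)
    cycle    : ∀ i → Adj G (cyc i) (cyc (next i))
    A-nonempty : ∀ i → ∃[ w ] lab w ≡ Data.Sum.inj₂ i
    A-adj    : ∀ w i → lab w ≡ Data.Sum.inj₂ i → ∀ x →
                 (Adj G w x → x ≡ cyc i ⊎ x ≡ cyc (next i) ⊎ (lab x ≡ Data.Sum.inj₂ i × x ≢ w))
               × (x ≡ cyc i ⊎ x ≡ cyc (next i) ⊎ (lab x ≡ Data.Sum.inj₂ i × x ≢ w) → Adj G w x)

IsOdd : ℕ → Set
IsOdd k = ∃[ m ] k ≡ suc (2 * m)

{-# OPTIONS --safe #-}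
module Submission where

-- Write k = 2m + 1 and look at the whole graph.  A vertex of A_i is adjacent only to A_i, v_i and
-- v_{i+1}, so a star containing it is centred in A_i ∪ {v_i, v_{i+1}}: each star meets at most
-- two of the k sets A_i, whence θ_S ≥ m + 1, and the stars centred at v_0, v_2, …, v_{2m} show
-- θ_S = m + 1.  Dually, every vertex t is equal or adjacent to two consecutive cycle vertices
-- v_i, v_{i+1} (i the index of t), and two S-independent vertices never share such a vertex; this
-- uses up 2|T| of the k cycle vertices, so α_S ≤ m, attained by one vertex from each of
-- A_0, A_2, …, A_{2m-2}.

open import Defs hiding (sym)
open import Data.Nat using (ℕ; zero; suc; _+_; _*_; _≤_; _<_; _%_; s≤s; s≤s⁻¹)
import Data.Nat.Properties as ℕ
open import Data.Nat.DivMod using (m<n⇒m%n≡m; n%n≡0)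
open import Data.Fin using (Fin; toℕ; fromℕ<; splitAt; join; inject₁; _≟_)
import Data.Fin as Fin
open import Data.Fin.Properties
  using ( toℕ-injective; toℕ-fromℕ<; toℕ<n; toℕ-inject₁; inject₁-injective; suc-injective
        ; injective⇒≤; splitAt-join; join-splitAt; any?)
open import Data.Fin.Subset using (Subset; _∈_; _⊆_; ∣_∣; ⊤; ⁅_⁆; _∪_; inside; outside)
open import Data.Fin.Subset.Properties using (∈⊤; x∈⁅x⁆; x∈⁅y⁆⇒x≡y; x∈p∪q⁻; x∈p∪q⁺)
open import Data.Vec using (_∷_; tabulate; here; there)
open import Data.Vec.Properties using (lookup∘tabulate; []=⇒lookup; lookup⇒[]=)
open import Data.Product using (∃; _×_; _,_; proj₁; proj₂)
open import Data.Sum using (_⊎_; inj₁; inj₂; [_,_]′)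
import Data.Sum as Sum
open import Data.Sum.Properties using (inj₁-injective; inj₂-injective)
open import Data.Unit using (tt)
open import Data.Bool using (T; true)
open import Function using (_∘_; const)
open import Function.Definitions using (Injective)
open import Relation.Unary using (Pred; Decidable)
open import Relation.Nullary using (¬_; Dec; yes; no; does; isYes; contradiction; _⊎-dec_)
open import Relation.Nullary.Decidable using (dec-true; toWitness; isYes≗does)
open import Relation.Binary.PropositionalEquality
  using (_≡_; _≢_; refl; sym; trans; cong; subst)

private
  variable
    a b c k n r s : ℕ

injective-into-⊎⇒≤ : (h : Fin a → Fin b ⊎ Fin c) → Injective _≡_ _≡_ h → a ≤ b + c
injective-into-⊎⇒≤ {b = b} {c} h h-inj = injective⇒≤ {f = join b c ∘ h} λ {i} {j} e →
  h-inj (trans (sym (splitAt-join b c (h i)))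
               (trans (cong (splitAt b) e) (splitAt-join b c (h j))))

disjoint-injections⇒≤ : (g : Fin a → Fin c) (h : Fin b → Fin c) →
  Injective _≡_ _≡_ g → Injective _≡_ _≡_ h → (∀ x y → g x ≢ h y) → a + b ≤ c
disjoint-injections⇒≤ {a} {b = b} g h g-inj h-inj g≢h =
  injective⇒≤ {f = [ g , h ]′ ∘ splitAt a} λ {i} {j} e →
    trans (sym (join-splitAt a b i))
          (trans (cong (join a b) ([g,h]-inj (splitAt a i) (splitAt a j) e)) (join-splitAt a b j))
  where
  [g,h]-inj : ∀ x y → [ g , h ]′ x ≡ [ g , h ]′ y → x ≡ y
  [g,h]-inj (inj₁ x) (inj₁ y) e = cong inj₁ (g-inj e)
  [g,h]-inj (inj₁ x) (inj₂ y) e = contradiction e (g≢h x y)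
  [g,h]-inj (inj₂ x) (inj₁ y) e = contradiction (sym e) (g≢h y x)
  [g,h]-inj (inj₂ x) (inj₂ y) e = cong inj₂ (h-inj e)

-- Each fibre of f has at most two points: the anchor of the fibre and its σ-preimage.
anchored⇒≤ : (f : Fin a → Fin s) (anchor : Fin s → Fin a) (σ : Fin a → Fin a) →
  Injective _≡_ _≡_ σ → (∀ i → i ≡ anchor (f i) ⊎ σ i ≡ anchor (f i)) → a ≤ s + s
anchored⇒≤ {a = a} {s = s} f anchor σ σ-inj anchored =
  injective-into-⊎⇒≤ side λ {i} {j} → side-inj (anchored i) (anchored j)
  where
  side : Fin a → Fin s ⊎ Fin s
  side i = Sum.map (const (f i)) (const (f i)) (anchored i)
  side-inj : ∀ {i j} (αi : i ≡ anchor (f i) ⊎ σ i ≡ anchor (f i))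
                     (αj : j ≡ anchor (f j) ⊎ σ j ≡ anchor (f j)) →
    Sum.map (const (f i)) (const (f i)) αi ≡ Sum.map (const (f j)) (const (f j)) αj → i ≡ j
  side-inj (inj₁ i≡) (inj₁ j≡) e = trans i≡ (trans (cong anchor (inj₁-injective e)) (sym j≡))
  side-inj (inj₂ σi≡) (inj₂ σj≡) e =
    σ-inj (trans σi≡ (trans (cong anchor (inj₂-injective e)) (sym σj≡)))

enum : (p : Subset n) → Fin ∣ p ∣ → Fin n
enum (inside ∷ p) Fin.zero = Fin.zero
enum (inside ∷ p) (Fin.suc x) = Fin.suc (enum p x)
enum (outside ∷ p) x = Fin.suc (enum p x)

enum-∈ : (p : Subset n) (x : Fin ∣ p ∣) → enum p x ∈ p
enum-∈ (inside ∷ p) Fin.zero = here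
enum-∈ (inside ∷ p) (Fin.suc x) = there (enum-∈ p x)
enum-∈ (outside ∷ p) x = there (enum-∈ p x)

enum-injective : (p : Subset n) → Injective _≡_ _≡_ (enum p)
enum-injective (inside ∷ p) {Fin.zero} {Fin.zero} e = refl
enum-injective (inside ∷ p) {Fin.suc x} {Fin.suc y} e =
  cong Fin.suc (enum-injective p (suc-injective e))
enum-injective (outside ∷ p) e = enum-injective p (suc-injective e)

rank : (p : Subset n) {x : Fin n} → x ∈ p → Fin ∣ p ∣
rank (inside ∷ p) here = Fin.zero
rank (inside ∷ p) (there x∈p) = Fin.suc (rank p x∈p)
rank (outside ∷ p) (there x∈p) = rank p x∈p

rank-injective : (p : Subset n) {x y : Fin n} (x∈p : x ∈ p) (y∈p : y ∈ p) →
  rank p x∈p ≡ rank p y∈p → x ≡ y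
rank-injective (inside ∷ p) here here e = refl
rank-injective (inside ∷ p) (there x∈p) (there y∈p) e =
  cong Fin.suc (rank-injective p x∈p y∈p (suc-injective e))
rank-injective (outside ∷ p) (there x∈p) (there y∈p) e =
  cong Fin.suc (rank-injective p x∈p y∈p e)

injective-into⇒≤∣∣ : (p : Subset n) (f : Fin r → Fin n) →
  (∀ x → f x ∈ p) → Injective _≡_ _≡_ f → r ≤ ∣ p ∣
injective-into⇒≤∣∣ p f f∈p f-inj =
  injective⇒≤ λ {x} {y} e → f-inj (rank-injective p (f∈p x) (f∈p y) e)

select : ∀ {ℓ} {P : Pred (Fin n) ℓ} → Decidable P → Subset n
select P? = tabulate (does ∘ P?)

∈-select⁺ : ∀ {ℓ} {P : Pred (Fin n) ℓ} (P? : Decidable P) {x} → P x → x ∈ select P?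
∈-select⁺ P? {x} px =
  lookup⇒[]= x _ (trans (lookup∘tabulate (does ∘ P?) x) (dec-true (P? x) px))

∈-select⁻ : ∀ {ℓ} {P : Pred (Fin n) ℓ} (P? : Decidable P) {x} → x ∈ select P? → P x
∈-select⁻ P? {x} x∈ = toWitness {a? = P? x} (subst T (sym isYes≡true) tt)
  where
  isYes≡true : isYes (P? x) ≡ true
  isYes≡true =
    trans (isYes≗does (P? x)) (trans (sym (lookup∘tabulate (does ∘ P?) x)) ([]=⇒lookup x∈))

toℕ-next-< : (i : Fin (suc k)) → suc (toℕ i) < suc k → toℕ (next i) ≡ suc (toℕ i)
toℕ-next-< i lt = trans (toℕ-fromℕ< _) (m<n⇒m%n≡m lt)

toℕ-next-last : (i : Fin (suc k)) → toℕ i ≡ k → toℕ (next i) ≡ 0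
toℕ-next-last {k} i i≡k =
  trans (toℕ-fromℕ< _) (subst (λ z → suc z % suc k ≡ 0) (sym i≡k) (n%n≡0 (suc k)))

toℕ-next : (i : Fin (suc k)) → toℕ (next i) ≡ suc (toℕ i) ⊎ (toℕ i ≡ k × toℕ (next i) ≡ 0)
toℕ-next i with ℕ.m≤n⇒m<n∨m≡n (s≤s⁻¹ (toℕ<n i))
... | inj₁ i<k = inj₁ (toℕ-next-< i (s≤s i<k))
... | inj₂ i≡k = inj₂ (i≡k , toℕ-next-last i i≡k)

next-injective : Injective _≡_ _≡_ (next {suc k})
next-injective {x = i} {j} e with toℕ-next i | toℕ-next j
... | inj₁ ni | inj₁ nj =
  toℕ-injective (ℕ.suc-injective (trans (sym ni) (trans (cong toℕ e) nj)))
... | inj₁ ni | inj₂ (_ , nj) = contradiction (trans (sym nj) (trans (cong toℕ (sym e)) ni)) ℕ.0≢1+n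
... | inj₂ (_ , ni) | inj₁ nj = contradiction (trans (sym ni) (trans (cong toℕ e) nj)) ℕ.0≢1+n
... | inj₂ (i≡k , _) | inj₂ (j≡k , _) = toℕ-injective (trans i≡k (sym j≡k))

next-≢ : 1 ≤ k → (i : Fin (suc k)) → next i ≢ i
next-≢ 1≤k i e with toℕ-next i
... | inj₁ ni = ℕ.1+n≢n (trans (sym ni) (cong toℕ e))
... | inj₂ (i≡k , ni) = ℕ.<⇒≢ 1≤k (trans (sym ni) (trans (cong toℕ e) i≡k))

next-by-toℕ : {i j : Fin (suc k)} → toℕ j ≡ suc (toℕ i) → next i ≡ j
next-by-toℕ {k} {i} {j} e =
  toℕ-injective (trans (toℕ-next-< i (subst (_< suc k) e (toℕ<n j))) (sym e))

even-or-odd : ∀ n → ∃ λ q → n ≡ 2 * q ⊎ n ≡ suc (2 * q)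
even-or-odd zero = 0 , inj₁ refl
even-or-odd (suc zero) = 0 , inj₂ refl
even-or-odd (suc (suc n)) with q , n≡ ← even-or-odd n =
  suc q , Sum.map (λ e → trans (cong (2 +_) e) (sym (ℕ.*-suc 2 q)))
                  (λ e → trans (cong (2 +_) e) (cong suc (sym (ℕ.*-suc 2 q)))) n≡

+-self≡2* : ∀ r → r + r ≡ 2 * r
+-self≡2* r = cong (r +_) (sym (ℕ.+-identityʳ r))

+-self≤odd⇒≤ : ∀ {r m} → r + r ≤ suc (2 * m) → r ≤ m
+-self≤odd⇒≤ {r} {m} le = s≤s⁻¹ (ℕ.*-cancelˡ-< 2 r (suc m)
  (subst (2 * r <_) (sym (ℕ.*-suc 2 m)) (s≤s (subst (_≤ suc (2 * m)) (+-self≡2* r) le))))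

odd≤+-self⇒< : ∀ {m s} → suc (2 * m) ≤ s + s → m < s
odd≤+-self⇒< {m} {s} le = ℕ.*-cancelˡ-< 2 m s (subst (suc (2 * m) ≤_) (+-self≡2* s) le)

module _ {m : ℕ} where

  even : Fin (suc m) → Fin (suc (2 * m))
  even y = fromℕ< (s≤s (ℕ.*-monoʳ-≤ 2 (s≤s⁻¹ (toℕ<n y))))

  odd : Fin m → Fin (suc (2 * m))
  odd y = fromℕ< (s≤s (ℕ.*-monoʳ-< 2 (toℕ<n y)))

  toℕ-even : (y : Fin (suc m)) → toℕ (even y) ≡ 2 * toℕ y
  toℕ-even y = toℕ-fromℕ< _

  toℕ-odd : (y : Fin m) → toℕ (odd y) ≡ suc (2 * toℕ y)
  toℕ-odd y = toℕ-fromℕ< (s≤s (ℕ.*-monoʳ-< 2 (toℕ<n y)))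

  even-injective : Injective _≡_ _≡_ even
  even-injective {x} {y} e = toℕ-injective (ℕ.*-cancelˡ-≡ (toℕ x) (toℕ y) 2
    (trans (sym (toℕ-even x)) (trans (cong toℕ e) (toℕ-even y))))

  odd-injective : Injective _≡_ _≡_ odd
  odd-injective {x} {y} e = toℕ-injective (ℕ.*-cancelˡ-≡ (toℕ x) (toℕ y) 2
    (ℕ.suc-injective (trans (sym (toℕ-odd x)) (trans (cong toℕ e) (toℕ-odd y)))))

  even≢odd : ∀ x y → even x ≢ odd y
  even≢odd x y e = ℕ.even≢odd (toℕ x) (toℕ y)
    (trans (sym (toℕ-even x)) (trans (cong toℕ e) (toℕ-odd y)))

  parity : (i : Fin (suc (2 * m))) → (∃ λ y → i ≡ even y) ⊎ (∃ λ y → i ≡ odd y)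
  parity i with even-or-odd (toℕ i)
  ... | q , inj₁ i≡2q = inj₁ (y , toℕ-injective
        (trans i≡2q (sym (trans (toℕ-even y) (cong (2 *_) (toℕ-fromℕ< {m = q} _))))))
    where
    y : Fin (suc m)
    y = fromℕ< (s≤s (ℕ.*-cancelˡ-≤ {q} {m} 2 (s≤s⁻¹ (subst (_< suc (2 * m)) i≡2q (toℕ<n i)))))
  ... | q , inj₂ i≡2q+1 = inj₂ (y , toℕ-injective
        (trans i≡2q+1 (sym (trans (toℕ-odd y) (cong (suc ∘ (2 *_)) (toℕ-fromℕ< {m = q} _))))))
    where
    y : Fin m
    y = fromℕ< (ℕ.*-cancelˡ-< 2 q m (s≤s⁻¹ (subst (_< suc (2 * m)) i≡2q+1 (toℕ<n i))))

  next-even : (y : Fin m) → next (even (inject₁ y)) ≡ odd y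
  next-even y = next-by-toℕ (trans (toℕ-odd y)
    (cong suc (sym (trans (toℕ-even (inject₁ y)) (cong (2 *_) (toℕ-inject₁ y))))))

  next-odd : (y : Fin m) → next (odd y) ≡ even (Fin.suc y)
  next-odd y = next-by-toℕ (trans (toℕ-even (Fin.suc y))
    (trans (ℕ.*-suc 2 (toℕ y)) (cong suc (sym (toℕ-odd y)))))

module _ {n} (G : Graph n) where

  Near : Fin n → Fin n → Set
  Near c v = v ≡ c ⊎ Adj G c v

  near-adj : ∀ {c v} → Near c v → v ≢ c → Adj G c v
  near-adj (inj₁ v≡c) v≢c = contradiction v≡c v≢c
  near-adj (inj₂ adj) _ = adj

  centre : ∀ {U S} → IsStar G U S → Fin n
  centre (_ , c , _) = c

  star-near-centre : ∀ {U S v} (st : IsStar G U S) → v ∈ S → Near (centre st) v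
  star-near-centre {v = v} (_ , c , _ , adj) v∈S with v ≟ c
  ... | yes v≡c = inj₁ v≡c
  ... | no v≢c = inj₂ (adj v v∈S v≢c)

  near-star : ∀ {U c u v} → c ∈ U → u ∈ U → v ∈ U → Near c u → Near c v →
    IsStar G U (⁅ c ⁆ ∪ (⁅ u ⁆ ∪ ⁅ v ⁆))
  near-star {U} {c} {u} {v} c∈U u∈U v∈U near-u near-v =
    ⊆U , c , x∈p∪q⁺ (inj₁ (x∈⁅x⁆ c)) , λ w w∈ w≢c → adjacent w (members w∈) w≢c
    where
    members : ∀ {w} → w ∈ ⁅ c ⁆ ∪ (⁅ u ⁆ ∪ ⁅ v ⁆) → w ≡ c ⊎ w ≡ u ⊎ w ≡ v
    members w∈ = Sum.map (x∈⁅y⁆⇒x≡y c) (Sum.map (x∈⁅y⁆⇒x≡y u) (x∈⁅y⁆⇒x≡y v) ∘ x∈p∪q⁻ _ _)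
                         (x∈p∪q⁻ _ _ w∈)
    ⊆U : ⁅ c ⁆ ∪ (⁅ u ⁆ ∪ ⁅ v ⁆) ⊆ U
    ⊆U w∈ with members w∈
    ... | inj₁ refl = c∈U
    ... | inj₂ (inj₁ refl) = u∈U
    ... | inj₂ (inj₂ refl) = v∈U
    adjacent : ∀ w → w ≡ c ⊎ w ≡ u ⊎ w ≡ v → w ≢ c → Adj G c w
    adjacent w (inj₁ w≡c) w≢c = contradiction w≡c w≢c
    adjacent w (inj₂ (inj₁ refl)) w≢c = near-adj near-u w≢c
    adjacent w (inj₂ (inj₂ refl)) w≢c = near-adj near-v w≢c

  SIndep-near : ∀ {U T c u v} → IsSIndep G U T → c ∈ U → u ∈ T → v ∈ T →
    Near c u → Near c v → u ≡ v
  SIndep-near {u = u} {v} (T⊆U , indep) c∈U u∈T v∈T near-u near-v with u ≟ v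
  ... | yes u≡v = u≡v
  ... | no u≢v = contradiction
        (_ , near-star c∈U (T⊆U u∈T) (T⊆U v∈T) near-u near-v ,
         x∈p∪q⁺ (inj₂ (x∈p∪q⁺ (inj₁ (x∈⁅x⁆ u)))) , x∈p∪q⁺ (inj₂ (x∈p∪q⁺ (inj₂ (x∈⁅x⁆ v)))))
        (indep u v u∈T v∈T u≢v)

module OddSun {n} (G : Graph n) (m : ℕ) (E : ExtendedSun G (suc (2 * m))) where
  open ExtendedSun E

  pos : Fin n → Fin (suc (2 * m))
  pos w = Sum.reduce (lab w)

  pos-cyc : ∀ i → pos (cyc i) ≡ i
  pos-cyc i = cong Sum.reduce (cyc-lab i)

  near-cyc-pos : ∀ t → Near G (cyc (pos t)) t
  near-cyc-pos t with lab t in eq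
  ... | inj₁ i = inj₁ (lab-cyc t i eq)
  ... | inj₂ i = inj₂ (Graph.sym G (proj₂ (A-adj t i eq (cyc i)) (inj₁ refl)))

  near-cyc-next-pos : ∀ t → Near G (cyc (next (pos t))) t
  near-cyc-next-pos t with lab t in eq
  ... | inj₁ i = inj₂ (subst (Adj G (cyc (next i))) (sym (lab-cyc t i eq)) (Graph.sym G (cycle i)))
  ... | inj₂ i = inj₂ (Graph.sym G (proj₂ (A-adj t i eq (cyc (next i))) (inj₂ (inj₁ refl))))

  rep : Fin (suc (2 * m)) → Fin n
  rep i = proj₁ (A-nonempty i)

  lab-rep : ∀ i → lab (rep i) ≡ inj₂ i
  lab-rep i = proj₂ (A-nonempty i)

  rep-injective : Injective _≡_ _≡_ rep
  rep-injective {i} {j} e =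
    inj₂-injective (trans (sym (lab-rep i)) (trans (cong lab e) (lab-rep j)))

  near-rep : ∀ {c} i → Near G c (rep i) → i ≡ pos c ⊎ next i ≡ pos c
  near-rep i (inj₁ refl) = inj₁ (sym (cong Sum.reduce (lab-rep i)))
  near-rep {c} i (inj₂ adj) with proj₁ (A-adj (rep i) i (lab-rep i) c) (Graph.sym G adj)
  ... | inj₁ refl = inj₁ (sym (pos-cyc i))
  ... | inj₂ (inj₁ refl) = inj₂ (sym (pos-cyc (next i)))
  ... | inj₂ (inj₂ (lab-c , _)) = inj₁ (sym (cong Sum.reduce lab-c))

  -- The labels of {v_p, v_{p+1}} ∪ A_p ∪ A_{p-1}, which is the vertex set of a star centred at v_p.
  Around : Fin (suc (2 * m)) → Fin (suc (2 * m)) ⊎ Fin (suc (2 * m)) → Set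
  Around p (inj₁ q) = q ≡ p ⊎ q ≡ next p
  Around p (inj₂ q) = q ≡ p ⊎ next q ≡ p

  around? : ∀ p l → Dec (Around p l)
  around? p (inj₁ q) = q ≟ p ⊎-dec q ≟ next p
  around? p (inj₂ q) = q ≟ p ⊎-dec next q ≟ p

  around-centre : ∀ p → Around p (lab (cyc p))
  around-centre p rewrite cyc-lab p = inj₁ refl

  around-adj : ∀ p w → Around p (lab w) → w ≢ cyc p → Adj G (cyc p) w
  around-adj p w around w≢ with lab w in eq
  around-adj p w (inj₁ refl) w≢ | inj₁ q = contradiction (lab-cyc w q eq) w≢
  around-adj p w (inj₂ refl) w≢ | inj₁ q =
    subst (Adj G (cyc p)) (sym (lab-cyc w q eq)) (cycle p)
  around-adj p w (inj₁ refl) w≢ | inj₂ q =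
    Graph.sym G (proj₂ (A-adj w q eq (cyc q)) (inj₁ refl))
  around-adj p w (inj₂ refl) w≢ | inj₂ q =
    Graph.sym G (proj₂ (A-adj w q eq (cyc (next q))) (inj₂ (inj₁ refl)))

  around-even : ∀ l → ∃ λ (j : Fin (suc m)) → Around (even j) l
  around-even (inj₁ i) with parity {m} i
  ... | inj₁ (y , refl) = y , inj₁ refl
  ... | inj₂ (y , refl) = inject₁ y , inj₂ (sym (next-even y))
  around-even (inj₂ i) with parity {m} i
  ... | inj₁ (y , refl) = y , inj₁ refl
  ... | inj₂ (y , refl) = Fin.suc y , inj₂ (next-odd y)

  around-even? : (j : Fin (suc m)) → Decidable (λ w → Around (even j) (lab w))
  around-even? j w = around? (even j) (lab w)

  evenStar : Fin (suc m) → Subset n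
  evenStar j = select (around-even? j)

  evenStars-cover : IsStarCover G ⊤ (suc m) evenStar
  evenStars-cover = isStar , covers
    where
    isStar : ∀ j → IsStar G ⊤ (evenStar j)
    isStar j = (λ _ → ∈⊤) , cyc (even j) , ∈-select⁺ (around-even? j) (around-centre (even j)) ,
               λ w w∈ w≢ → around-adj (even j) w (∈-select⁻ (around-even? j) w∈) w≢
    covers : ∀ w → w ∈ ⊤ → ∃ λ j → w ∈ evenStar j
    covers w _ = let j , around = around-even (lab w) in j , ∈-select⁺ (around-even? j) around

  starCover-size : ∀ {s St} → IsStarCover G ⊤ s St → suc m ≤ s
  starCover-size {s} (stars , covers) =
    odd≤+-self⇒< (anchored⇒≤ f anchor next next-injective anchored)
    where
    f : Fin (suc (2 * m)) → Fin s
    f i = proj₁ (covers (rep i) ∈⊤)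
    anchor : Fin s → Fin (suc (2 * m))
    anchor j = pos (centre G (stars j))
    anchored : ∀ i → i ≡ anchor (f i) ⊎ next i ≡ anchor (f i)
    anchored i = near-rep i (star-near-centre G (stars (f i)) (proj₂ (covers (rep i) ∈⊤)))

  θS≡1+m : IsThetaS G ⊤ (suc m)
  θS≡1+m = (evenStar , evenStars-cover) , λ _ _ → starCover-size

  SIndep-size : ∀ {T} → IsSIndep G ⊤ T → ∣ T ∣ ≤ m
  SIndep-size {T} indep = +-self≤odd⇒≤ (disjoint-injections⇒≤ g h g-inj h-inj g≢h)
    where
    t : Fin ∣ T ∣ → Fin n
    t = enum T
    common-near⇒≡ : ∀ {c x y} → Near G c (t x) → Near G c (t y) → x ≡ y
    common-near⇒≡ near-x near-y =
      enum-injective T (SIndep-near G indep ∈⊤ (enum-∈ T _) (enum-∈ T _) near-x near-y)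
    near-cyc : ∀ {i j} y → i ≡ j → Near G (cyc j) (t y) → Near G (cyc i) (t y)
    near-cyc y i≡j = subst (λ i → Near G (cyc i) (t y)) (sym i≡j)
    g h : Fin ∣ T ∣ → Fin (suc (2 * m))
    g x = pos (t x)
    h x = next (pos (t x))
    g-inj : Injective _≡_ _≡_ g
    g-inj {x} {y} e = common-near⇒≡ (near-cyc-pos (t x)) (near-cyc y e (near-cyc-pos (t y)))
    h-inj : Injective _≡_ _≡_ h
    h-inj {x} {y} e =
      common-near⇒≡ (near-cyc-next-pos (t x)) (near-cyc y e (near-cyc-next-pos (t y)))
    g≢h : ∀ x y → g x ≢ h y
    g≢h x y e with common-near⇒≡ (near-cyc-pos (t x)) (near-cyc y e (near-cyc-next-pos (t y)))
    ... | refl = next-≢ (ℕ.<⇒≤ (s≤s⁻¹ k≥3)) (g x) (sym e)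

  evenRep : Fin m → Fin n
  evenRep x = rep (even (inject₁ x))

  evenRep? : Decidable (λ w → ∃ λ x → w ≡ evenRep x)
  evenRep? w = any? (λ x → w ≟ evenRep x)

  evenReps : Subset n
  evenReps = select evenRep?

  evenReps-SIndep : IsSIndep G ⊤ evenReps
  evenReps-SIndep = (λ _ → ∈⊤) , apart
    where
    same-centre : ∀ {c} (x y : Fin m) →
      even (inject₁ x) ≡ c ⊎ odd x ≡ c → even (inject₁ y) ≡ c ⊎ odd y ≡ c → x ≡ y
    same-centre x y (inj₁ ex) (inj₁ ey) = inject₁-injective (even-injective (trans ex (sym ey)))
    same-centre x y (inj₁ ex) (inj₂ oy) = contradiction (trans ex (sym oy)) (even≢odd (inject₁ x) y)
    same-centre x y (inj₂ ox) (inj₁ ey) = contradiction (trans ey (sym ox)) (even≢odd (inject₁ y) x)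
    same-centre x y (inj₂ ox) (inj₂ oy) = odd-injective (trans ox (sym oy))
    centre-pos : ∀ {S} (st : IsStar G ⊤ S) x → evenRep x ∈ S →
      even (inject₁ x) ≡ pos (centre G st) ⊎ odd x ≡ pos (centre G st)
    centre-pos st x x∈S = Sum.map₂ (trans (sym (next-even x)))
      (near-rep (even (inject₁ x)) (star-near-centre G st x∈S))
    apart : ∀ u v → u ∈ evenReps → v ∈ evenReps → u ≢ v →
      ¬ (∃ λ S → IsStar G ⊤ S × u ∈ S × v ∈ S)
    apart u v u∈ v∈ u≢v (S , st , u∈S , v∈S) with ∈-select⁻ evenRep? u∈ | ∈-select⁻ evenRep? v∈
    ... | x , refl | y , refl =
      u≢v (cong evenRep (same-centre x y (centre-pos st x u∈S) (centre-pos st y v∈S)))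

  m≤∣evenReps∣ : m ≤ ∣ evenReps ∣
  m≤∣evenReps∣ = injective-into⇒≤∣∣ evenReps evenRep
    (λ x → ∈-select⁺ evenRep? (x , refl))
    (inject₁-injective ∘ even-injective ∘ rep-injective)

  αS≡∣evenReps∣ : IsAlphaS G ⊤ ∣ evenReps ∣
  αS≡∣evenReps∣ = (evenReps , evenReps-SIndep , refl) ,
                  λ _ indep → ℕ.≤-trans (SIndep-size indep) m≤∣evenReps∣

lemma2p12 : ∀ {n} (G : Graph n) (k : ℕ) → IsOdd k → ExtendedSun G k → ¬ SPerfect G
lemma2p12 G .(suc (2 * m)) (m , refl) E sperfect =
  ℕ.1+n≰n (subst (_≤ m) αS≡θS (SIndep-size evenReps-SIndep))
  where
  open OddSun G m E
  αS≡θS : ∣ evenReps ∣ ≡ suc m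
  αS≡θS = sperfect ⊤ ∣ evenReps ∣ (suc m) αS≡∣evenReps∣ θS≡1+m
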